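{- For all integers $m\ge 2$ and $n\ge 1$, the stacked prism $Y_{2^m,n}$ is odd prime.
   Context: All graphs are finite and simple. An odd prime labeling of a graph $G$ with $N$ vertices is a bijection $\ell:V(G)\to\{1,3,\dots,2N-1\}$ such that $\gcd(\ell(u),\ell(v))=1$ for every edge $uv$; $G$ is odd prime if it has one. For $k\ge 3$, $n\ge 1$, the stacked prism $Y_{k,n}$ is the Cartesian product $C_k\,\square\,P_n$ of the cycle on $k$ vertices with the path on $n$ vertices: its vertices are $v_{i,j}$ ($1\le i\le n$, $1\le j\le k$), with edges $v_{i,j}v_{i,j+1}$ ($1\le j\le k-1$) and $v_{i,k}v_{i,1}$ for each $i$, and $v_{i,j}v_{i+1,j}$ for $1\le i\le n-1$, $1\le j\le k$. -}

module Defs where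

open import Data.Nat using (ℕ; suc; _+_; _*_; _%_; _≥_)
open import Data.Nat.Coprimality using (Coprime)
open import Data.Fin using (Fin; toℕ)
open import Data.Product using (_×_; Σ; _,_)
open import Data.Sum using (_⊎_)
open import Function.Bundles using (Bijection; module Bijection)
open import Relation.Binary.PropositionalEquality using (_≡_)

oddLabel : {N : ℕ} → Fin N → ℕ
oddLabel i = 2 * toℕ i + 1

-- An odd prime labeling of a graph with vertex type V, N vertices and
-- adjacency relation Adj: a bijection σ : V → Fin N (so ℓ = oddLabel ∘ σ
-- is a bijection V → {1,3,…,2N-1}) such that gcd(ℓ u, ℓ v) = 1 on every edge.
OddPrimeLabeling : (V : Set) (N : ℕ) (Adj : V → V → Set) → Set
OddPrimeLabeling V N Adj =
  Σ (Bijection (Relation.Binary.PropositionalEquality.setoid V)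
               (Relation.Binary.PropositionalEquality.setoid (Fin N)))
    λ σ → ∀ u v → Adj u v →
            Coprime (oddLabel (Bijection.to σ u)) (oddLabel (Bijection.to σ v))
  where import Relation.Binary.PropositionalEquality

-- Stacked prism Y_{k,n} = C_k □ P_n.  Vertex v_{i,j} (1 ≤ i ≤ n, 1 ≤ j ≤ k)
-- is represented by (i-1 , j-1) : Fin n × Fin k; there are n * k vertices.
PrismVertex : (k n : ℕ) → Set
PrismVertex k n = Fin n × Fin k

CycleStep : (k : ℕ) → Fin k → Fin k → Set
CycleStep (suc k) j j' = toℕ j' ≡ (suc (toℕ j)) % (suc k)
CycleStep ℕ.zero () _

PathStep : (n : ℕ) → Fin n → Fin n → Set
PathStep n i i' = toℕ i' ≡ suc (toℕ i)

PrismAdj : (k n : ℕ) → PrismVertex k n → PrismVertex k n → Set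
PrismAdj k n (i , j) (i' , j') =
    (i ≡ i' × (CycleStep k j j' ⊎ CycleStep k j' j))
  ⊎ (j ≡ j' × (PathStep n i i' ⊎ PathStep n i' i))

StackedPrismOddPrime : (k n : ℕ) → Set
StackedPrismOddPrime k n = OddPrimeLabeling (PrismVertex k n) (n * k) (PrismAdj k n)

-- Give v_{i,j} the label 2 (k i + π j) + 1, where π numbers the columns going around the
-- cycle as 0, 2, 4, …, k−2 on the first half and k−1, …, 3, 1 on the way back (fold the cycle
-- in half and interleave the two halves).  Cyclically consecutive columns, the wrap-around pair
-- included, then get numbers differing by 1 or 2, and vertically adjacent vertices numbers
-- differing by k = 2^m.  So every edge joins odd labels whose difference is a power of two,
-- and such labels are coprime: a common divisor is odd and divides a power of two.
module Submission where

open import Defs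
open import Data.Nat using (ℕ; zero; suc; _+_; _*_; _^_; _∸_; _≤_; _<_; _≥_; z<s; _<?_)
open import Data.Nat.Properties
open import Data.Nat.DivMod using (_%_; m<n⇒m%n≡m; n%n≡0)
open import Data.Nat.Tactic.RingSolver using (solve-∀)
open import Data.Nat.Divisibility using (∣-trans; ∣1⇒≡1; ∣m+n∣m⇒∣n; m∣m*n)
open import Data.Nat.Coprimality using (Coprime; coprime-divisor; coprime-+)
import Data.Nat.Coprimality as Coprime
open import Data.Nat.Primality using (irreducible[2])
open import Data.Fin using (Fin; toℕ; cast; combine; opposite; reduce≥; fromℕ<)
open import Data.Fin.Patterns using (0F; 1F)
open import Data.Fin.Properties
  using (toℕ-cast; cast-involutive; toℕ-combine; toℕ-fromℕ<; toℕ-↑ʳ; opposite-prop; opposite-involutive; toℕ<n;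
         splitAt-<; splitAt-≥; splitAt⁻¹-↑ʳ; +↔⊎; *↔×)
open import Data.Product using (∃-syntax; _×_; _,_)
open import Data.Product.Function.NonDependent.Propositional using (_×-↔_)
open import Data.Sum using (_⊎_; inj₁; inj₂)
open import Function.Bundles using (Inverse; _↔_; mk↔ₛ′)
open import Function.Construct.Composition using (_↔-∘_)
open import Function.Construct.Symmetry using (↔-sym)
open import Function.Construct.Identity using (↔-id)
open import Function.Properties.Inverse using (Inverse⇒Bijection)
open import Relation.Binary.PropositionalEquality
open import Relation.Nullary using (yes; no)

private variable
  c m n k x y : ℕ

coprime-*ʳ : Coprime m n → Coprime m k → Coprime m (n * k)
coprime-*ʳ m⊥n m⊥k (d∣m , d∣n*k) =
  m⊥k (d∣m , coprime-divisor (λ (c∣d , c∣n) → m⊥n (∣-trans c∣d d∣m , c∣n)) d∣n*k)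

coprime-^ʳ : ∀ e → Coprime m n → Coprime m (n ^ e)
coprime-^ʳ zero    _   (_ , d∣1) = ∣1⇒≡1 d∣1
coprime-^ʳ (suc e) m⊥n = coprime-*ʳ m⊥n (coprime-^ʳ e m⊥n)

odd-coprime-2 : ∀ x → Coprime (2 * x + 1) 2
odd-coprime-2 x (d∣odd , d∣2) with irreducible[2] d∣2
... | inj₁ d≡1 = d≡1
... | inj₂ refl with () ← ∣1⇒≡1 (∣m+n∣m⇒∣n d∣odd (m∣m*n x))

odd-coprime-+-2^ : ∀ x e → Coprime (2 * x + 1) (2 * (x + 2 ^ e) + 1)
odd-coprime-+-2^ x e = subst (Coprime (2 * x + 1)) (sym (shift x (2 ^ e)))
  (Coprime.sym (coprime-+ (Coprime.sym (coprime-^ʳ (suc e) (odd-coprime-2 x)))))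
  where
  shift : ∀ a b → 2 * (a + b) + 1 ≡ 2 * a + 1 + 2 * b
  shift = solve-∀

TwoPowerApart : ℕ → ℕ → Set
TwoPowerApart x y = ∃[ e ] (y ≡ x + 2 ^ e ⊎ x ≡ y + 2 ^ e)

twoPowerApart-sym : TwoPowerApart x y → TwoPowerApart y x
twoPowerApart-sym (e , inj₁ y≡x+2^e) = e , inj₂ y≡x+2^e
twoPowerApart-sym (e , inj₂ x≡y+2^e) = e , inj₁ x≡y+2^e

twoPowerApart-+ˡ : ∀ c → TwoPowerApart x y → TwoPowerApart (c + x) (c + y)
twoPowerApart-+ˡ {x}     c (e , inj₁ refl) = e , inj₁ (sym (+-assoc c x (2 ^ e)))
twoPowerApart-+ˡ {y = y} c (e , inj₂ refl) = e , inj₂ (sym (+-assoc c y (2 ^ e)))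

twoPowerApart⇒odd-coprime : TwoPowerApart x y → Coprime (2 * x + 1) (2 * y + 1)
twoPowerApart⇒odd-coprime {x}     (e , inj₁ refl) = odd-coprime-+-2^ x e
twoPowerApart⇒odd-coprime {y = y} (e , inj₂ refl) = Coprime.sym (odd-coprime-+-2^ y e)

cast↔ : m ≡ n → Fin m ↔ Fin n
cast↔ eq = mk↔ₛ′ (cast eq) (cast (sym eq)) (cast-involutive eq (sym eq)) (cast-involutive (sym eq) eq)

cycleStep-cases : ∀ {K} {j j' : Fin K} → CycleStep K j j' →
                  suc (toℕ j) ≡ toℕ j' ⊎ (suc (toℕ j) ≡ K × toℕ j' ≡ 0)
cycleStep-cases {suc k} {j} step with suc (toℕ j) <? suc k
... | yes j+1<K = inj₁ (sym (trans step (m<n⇒m%n≡m j+1<K)))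
... | no  j+1≮K = inj₂ (j+1≡K , trans step (trans (cong (_% suc k) j+1≡K) (n%n≡0 (suc k))))
  where
  j+1≡K : suc (toℕ j) ≡ suc k
  j+1≡K = ≤-antisym (toℕ<n j) (≮⇒≥ j+1≮K)

lastIndex-bounds : ∀ {c h} → suc c ≡ h + h → 0 < h × h ≤ c
lastIndex-bounds {h = suc h} refl = z<s , m≤n+m (suc h) h

mirror : c < n → ∃[ s ] suc (s + c) ≡ n
mirror {c} c<n with s , c+1+s≡n ← m≤n⇒∃[o]m+o≡n c<n = s , trans (cong suc (+-comm s c)) c+1+s≡n

module _ (h : ℕ) where

  foldHalves↔ : (Fin h ⊎ Fin h) ↔ (Fin h × Fin 2)
  foldHalves↔ = mk↔ₛ′ fold unfold fold∘unfold unfold∘fold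
    where
    fold : Fin h ⊎ Fin h → Fin h × Fin 2
    fold (inj₁ i) = i , 0F
    fold (inj₂ i) = opposite i , 1F
    unfold : Fin h × Fin 2 → Fin h ⊎ Fin h
    unfold (i , 0F) = inj₁ i
    unfold (i , 1F) = inj₂ (opposite i)
    fold∘unfold : ∀ p → fold (unfold p) ≡ p
    fold∘unfold (i , 0F) = refl
    fold∘unfold (i , 1F) = cong (_, 1F) (opposite-involutive i)
    unfold∘fold : ∀ s → unfold (fold s) ≡ s
    unfold∘fold (inj₁ i) = refl
    unfold∘fold (inj₂ i) = cong inj₂ (opposite-involutive i)

  h*2≡h+h : h * 2 ≡ h + h
  h*2≡h+h = trans (*-comm h 2) (cong (h +_) (+-identityʳ h))

  zigzag : Fin (h + h) ↔ Fin (h + h)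
  zigzag = cast↔ h*2≡h+h ↔-∘ (↔-sym *↔× ↔-∘ (foldHalves↔ ↔-∘ +↔⊎))

  position : Fin (h + h) → ℕ
  position j = toℕ (Inverse.to zigzag j)

  position-low : (j : Fin (h + h)) → toℕ j < h → position j ≡ 2 * toℕ j
  position-low j j<h rewrite splitAt-< h j j<h = begin
    toℕ (cast h*2≡h+h (combine (fromℕ< j<h) 0F)) ≡⟨ toℕ-cast h*2≡h+h _ ⟩
    toℕ (combine (fromℕ< j<h) 0F)                 ≡⟨ toℕ-combine (fromℕ< j<h) 0F ⟩
    2 * toℕ (fromℕ< j<h) + 0                     ≡⟨ +-identityʳ _ ⟩
    2 * toℕ (fromℕ< j<h)                         ≡⟨ cong (2 *_) (toℕ-fromℕ< j<h) ⟩
    2 * toℕ j                                    ∎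
    where open ≡-Reasoning

  position-high : ∀ s (j : Fin (h + h)) → h ≤ toℕ j → suc (s + toℕ j) ≡ h + h → position j ≡ 2 * s + 1
  position-high s j h≤j s+j+1≡2h rewrite splitAt-≥ h j h≤j = begin
    toℕ (cast h*2≡h+h (combine (opposite i) 1F)) ≡⟨ toℕ-cast h*2≡h+h _ ⟩
    toℕ (combine (opposite i) 1F)                ≡⟨ toℕ-combine (opposite i) 1F ⟩
    2 * toℕ (opposite i) + 1                     ≡⟨ cong (λ t → 2 * t + 1) (opposite-prop i) ⟩
    2 * (h ∸ suc (toℕ i)) + 1                    ≡⟨ cong (λ t → 2 * t + 1) h∸suc-i≡s ⟩
    2 * s + 1                                    ∎
    where
    open ≡-Reasoning
    i = reduce≥ j h≤j
    j≡h+i : toℕ j ≡ h + toℕ i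
    j≡h+i = trans (cong toℕ (sym (splitAt⁻¹-↑ʳ (splitAt-≥ h j h≤j)))) (toℕ-↑ʳ h i)
    +-suc-swap : ∀ a b c → a + (b + suc c) ≡ suc (b + (a + c))
    +-suc-swap = solve-∀
    s+suc-i≡h : s + suc (toℕ i) ≡ h
    s+suc-i≡h = +-cancelˡ-≡ h _ _ (begin
      h + (s + suc (toℕ i)) ≡⟨ +-suc-swap h s (toℕ i) ⟩
      suc (s + (h + toℕ i)) ≡⟨ cong (λ t → suc (s + t)) j≡h+i ⟨
      suc (s + toℕ j)       ≡⟨ s+j+1≡2h ⟩
      h + h                 ∎)
    h∸suc-i≡s : h ∸ suc (toℕ i) ≡ s
    h∸suc-i≡s = trans (cong (_∸ suc (toℕ i)) (sym s+suc-i≡h)) (m+n∸n≡m s (suc (toℕ i)))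

  position-suc : (j j' : Fin (h + h)) → suc (toℕ j) ≡ toℕ j' → TwoPowerApart (position j) (position j')
  position-suc j j' j+1≡j' with suc (toℕ j) <? h | toℕ j <? h
  ... | yes j+1<h | _ = subst₂ TwoPowerApart (sym pos-j) (sym pos-j') (1 , inj₁ (2*suc≡ (toℕ j)))
    where
    pos-j : position j ≡ 2 * toℕ j
    pos-j = position-low j (<-trans (n<1+n (toℕ j)) j+1<h)
    pos-j' : position j' ≡ 2 * suc (toℕ j)
    pos-j' = trans (position-low j' (subst (_< h) j+1≡j' j+1<h)) (cong (2 *_) (sym j+1≡j'))
    2*suc≡ : ∀ c → 2 * suc c ≡ 2 * c + 2
    2*suc≡ = solve-∀
  ... | no j+1≮h | yes j<h = subst₂ TwoPowerApart (sym pos-j) (sym pos-j') (0 , inj₁ refl)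
    where
    j+1≡h : suc (toℕ j) ≡ h
    j+1≡h = ≤-antisym j<h (≮⇒≥ j+1≮h)
    pos-j : position j ≡ 2 * toℕ j
    pos-j = position-low j j<h
    pos-j' : position j' ≡ 2 * toℕ j + 1
    pos-j' = position-high (toℕ j) j' (subst (h ≤_) j+1≡j' (≮⇒≥ j+1≮h)) (cong₂ _+_ j+1≡h (trans (sym j+1≡j') j+1≡h))
  ... | no _ | no j≮h with s , mirror-j' ← mirror (toℕ<n j') =
    subst₂ TwoPowerApart (sym pos-j) (sym pos-j') (1 , inj₂ (2*suc+1≡ s))
    where
    h≤j = ≮⇒≥ j≮h
    pos-j' : position j' ≡ 2 * s + 1
    pos-j' = position-high s j' (subst (h ≤_) j+1≡j' (m≤n⇒m≤1+n h≤j)) mirror-j'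
    mirror-j : suc (suc s + toℕ j) ≡ h + h
    mirror-j = trans (cong suc (sym (+-suc s (toℕ j)))) (trans (cong (λ t → suc (s + t)) j+1≡j') mirror-j')
    pos-j : position j ≡ 2 * suc s + 1
    pos-j = position-high (suc s) j h≤j mirror-j
    2*suc+1≡ : ∀ c → 2 * suc c + 1 ≡ 2 * c + 1 + 2
    2*suc+1≡ = solve-∀

  position-wrap : (j j' : Fin (h + h)) → suc (toℕ j) ≡ h + h → toℕ j' ≡ 0 →
                  TwoPowerApart (position j) (position j')
  position-wrap j j' j+1≡2h j'≡0 with 0<h , h≤j ← lastIndex-bounds j+1≡2h =
    subst₂ TwoPowerApart (sym pos-j) (sym pos-j') (0 , inj₂ refl)
    where
    pos-j : position j ≡ 1
    pos-j = position-high 0 j h≤j j+1≡2h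
    pos-j' : position j' ≡ 0
    pos-j' = trans (position-low j' (subst (_< h) (sym j'≡0) 0<h)) (cong (2 *_) j'≡0)

  position-cycleStep : {j j' : Fin (h + h)} → CycleStep (h + h) j j' →
                       TwoPowerApart (position j) (position j')
  position-cycleStep {j} {j'} step with cycleStep-cases step
  ... | inj₁ j+1≡j'          = position-suc j j' j+1≡j'
  ... | inj₂ (j+1≡2h , j'≡0) = position-wrap j j' j+1≡2h j'≡0

  vertexIndex : ∀ n → (Fin n × Fin (h + h)) ↔ Fin (n * (h + h))
  vertexIndex n = ↔-sym *↔× ↔-∘ (↔-id _ ×-↔ zigzag)

  index : PrismVertex (h + h) n → ℕ
  index {n} v = toℕ (Inverse.to (vertexIndex n) v)

  index≡K*i+position : (i : Fin n) (j : Fin (h + h)) → index (i , j) ≡ (h + h) * toℕ i + position j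
  index≡K*i+position i j = toℕ-combine i (Inverse.to zigzag j)

  index-pathStep : ∀ e → h + h ≡ 2 ^ e → (i i' : Fin n) (j : Fin (h + h)) → PathStep n i i' →
                   TwoPowerApart (index (i , j)) (index (i' , j))
  index-pathStep e K≡2^e i i' j i'≡i+1 = e , inj₁ (begin
    index (i' , j)                         ≡⟨ index≡K*i+position i' j ⟩
    K * toℕ i' + position j                ≡⟨ cong (λ t → K * t + position j) i'≡i+1 ⟩
    K * suc (toℕ i) + position j           ≡⟨ cong (_+ position j) (*-suc K (toℕ i)) ⟩
    K + K * toℕ i + position j             ≡⟨ +-assoc K _ _ ⟩
    K + (K * toℕ i + position j)           ≡⟨ +-comm K _ ⟩
    K * toℕ i + position j + K             ≡⟨ cong₂ _+_ (sym (index≡K*i+position i j)) K≡2^e ⟩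
    index (i , j) + 2 ^ e                  ∎)
    where
    open ≡-Reasoning
    K = h + h

  index-adjacent : ∀ e → h + h ≡ 2 ^ e → {u v : PrismVertex (h + h) n} → PrismAdj (h + h) n u v →
                   TwoPowerApart (index u) (index v)
  index-adjacent _ _ {i , j} {_ , j'} (inj₁ (refl , inj₁ step)) rewrite index≡K*i+position i j | index≡K*i+position i j' =
    twoPowerApart-+ˡ _ (position-cycleStep step)
  index-adjacent _ _ {i , j} {_ , j'} (inj₁ (refl , inj₂ step)) rewrite index≡K*i+position i j | index≡K*i+position i j' =
    twoPowerApart-sym (twoPowerApart-+ˡ _ (position-cycleStep step))
  index-adjacent e K≡2^e {i , j} {i' , _} (inj₂ (refl , inj₁ step)) = index-pathStep e K≡2^e i i' j step
  index-adjacent e K≡2^e {i , j} {i' , _} (inj₂ (refl , inj₂ step)) =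
    twoPowerApart-sym (index-pathStep e K≡2^e i' i j step)

stackedPrism-oddPrime : ∀ p n → StackedPrismOddPrime (2 ^ suc p) n
stackedPrism-oddPrime p n = subst (λ K → StackedPrismOddPrime K n) h+h≡2^[1+p]
  (Inverse⇒Bijection (vertexIndex h n) ,
   λ u v adj → twoPowerApart⇒odd-coprime (index-adjacent h (suc p) h+h≡2^[1+p] adj))
  where
  h = 2 ^ p
  h+h≡2^[1+p] : h + h ≡ 2 ^ suc p
  h+h≡2^[1+p] = cong (h +_) (sym (+-identityʳ h))

mainTheorem9 : (m n : ℕ) → m ≥ 2 → n ≥ 1 → StackedPrismOddPrime (2 ^ m) n
mainTheorem9 zero    n () _
mainTheorem9 (suc m) n _  _ = stackedPrism-oddPrime m n
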